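{- Let $n\ge1$ and let $G=(V,E)$ and $H=(V,F)$ be graphs on the common node set $V=\{1,\dots,n\}$ such that the edges of $H$ are pairwise node-disjoint. Let $t=\lvert F\rvert$, $k=n-t$, and let $V=V_1\cup\dots\cup V_k$ be the decomposition of $V$ into the node sets of the connected components of $H$. Assume that $E$ consists of exactly $\binom{k}{2}$ edges, namely for each $1\le i<j\le k$ exactly one edge $e_{ij}$, which joins a node of $V_i$ and a node of $V_j$. Assume $G$ contains a cycle $C$ of length four, and let $V_C$ be the set of its four nodes. Let $I(G,H)$ be the inequality in variables indexed by the edges of the complete graph on $V\cup\{n+1\}$ \[ \sum_{uv\in E} T(u,v;n+1)-\sum_{uv\in F}T(u,v;n+1)+2\sum_{i:\,V_i=\{u\}}x_{u,n+1}\le 2, \] and let $I'(G,H,C)$ be the inequality in variables indexed by the edges of the complete graph on $V\cup\{n+1,n+2\}$ \[ \sum_{uv\in E} T(u,v;n+1)-\sum_{uv\in F}T(u,v;n+1)+2\sum_{i:\,V_i=\{u\}}x_{u,n+1}+\sum_{u\in V_C}\bigl(x_{u,n+1}-x_{u,n+2}\bigr)\le 2, \] where $T(u,v;w)=x_{uv}-x_{uw}-x_{vw}$ and the sums $\sum_{i:V_i=\{u\}}$ run over the single-node components $V_i=\{u\}$. Let $S\subseteq V\cup\{n+2\}$. Then the cut vector $\boldsymbol{\delta}(S)$ (of the complete graph on $V\cup\{n+1,n+2\}$) satisfies $I'(G,H,C)$ with equality if one of the following holds: (i) $n+2\notin S$ and $\boldsymbol{\delta}(S)$ (as a cut vector of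 the complete graph on $V\cup\{n+1\}$) satisfies $I(G,H)$ with equality; (ii) $n+2\in S$, $S$ contains exactly two of the four nodes of $C$, and the cut vector $\boldsymbol{\delta}(S\setminus\{n+2\})$ of the complete graph on $V\cup\{n+1\}$ satisfies $I(G,H)$ with equality; (iii) $S=V_{c_1}\cup V_{c_2}\cup V_{c_3}\cup\{n+2\}$, where $V_{c_1},V_{c_2},V_{c_3}$ are three distinct components each containing a node of $C$.
   Context: For a graph with node set $W$ and edge set $D$, the cut vector $\boldsymbol{\delta}(S)\in\mathbb{R}^D$ of $S\subseteq W$ has $\delta_{uv}(S)=1$ if exactly one of $u,v$ lies in $S$, and $0$ otherwise. -}

module Defs where

open import Data.Nat using (ℕ; zero; suc)
open import Data.Fin using (Fin; zero; suc)
open import Data.Fin.Properties using (_≟_; _<?_)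
open import Data.Bool using (Bool; true; false; if_then_else_; _∧_; _∨_; _xor_; not)
open import Data.Integer using (ℤ; +_; _+_; _-_; _*_)
open import Data.Sum using (_⊎_)
open import Data.Product using (_×_)
open import Relation.Nullary using (does; ¬_)
open import Relation.Binary.PropositionalEquality using (_≡_)

record Graph (n : ℕ) : Set where
  field
    adj      : Fin n → Fin n → Bool
    symmetric : ∀ u v → adj u v ≡ adj v u
    loopless : ∀ u → adj u u ≡ false
open Graph public

ΣZ : ∀ {n} → (Fin n → ℤ) → ℤ
ΣZ {zero}  f = + 0
ΣZ {suc n} f = f zero + ΣZ (λ i → f (suc i))

ΣN : ∀ {n} → (Fin n → ℕ) → ℕ
ΣN {zero}  f = 0
ΣN {suc n} f = f zero Data.Nat.+ ΣN (λ i → f (suc i))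

anyF : ∀ {n} → (Fin n → Bool) → Bool
anyF {zero}  f = false
anyF {suc n} f = f zero ∨ anyF (λ i → f (suc i))

IsMatching : ∀ {n} → Graph n → Set
IsMatching H = ∀ u v w → adj H u v ≡ true → adj H u w ≡ true → v ≡ w

-- For a matching H, u and v lie in the same connected component of H
-- iff u = v or uv ∈ F.
SameComp : ∀ {n} → Graph n → Fin n → Fin n → Set
SameComp H u v = u ≡ v ⊎ adj H u v ≡ true

sameCompᵇ : ∀ {n} → Graph n → Fin n → Fin n → Bool
sameCompᵇ H u v = does (u ≟ v) ∨ adj H u v

isolated : ∀ {n} → Graph n → Fin n → Bool
isolated H u = not (anyF (adj H u))

-- Number of edges of G joining the component of u to the component of v
-- (counted as ordered pairs (a,b), a in comp(u), b in comp(v); for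
-- distinct components every edge is counted exactly once).
edgesBetween : ∀ {n} → Graph n → Graph n → Fin n → Fin n → ℕ
edgesBetween G H u v =
  ΣN λ a → ΣN λ b → if sameCompᵇ H u a ∧ sameCompᵇ H v b ∧ adj G a b then 1 else 0

ComponentCondition : ∀ {n} → Graph n → Graph n → Set
ComponentCondition G H =
  (∀ u v → adj G u v ≡ true → ¬ SameComp H u v) ×
  (∀ u v → ¬ SameComp H u v → edgesBetween G H u v ≡ 1)

data Node (n : ℕ) : Set where
  old  : Fin n → Node n
  new₁ : Node n
  new₂ : Node n

cut : ∀ {n} → (Node n → Bool) → Node n → Node n → ℤ
cut S u v = if S u xor S v then + 1 else + 0

removeNew₂ : ∀ {n} → (Node n → Bool) → Node n → Bool
removeNew₂ S new₂ = false
removeNew₂ S w    = S w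

edgeSum : ∀ {n} → Graph n → (Fin n → Fin n → ℤ) → ℤ
edgeSum A f = ΣZ λ u → ΣZ λ v → if does (u <? v) ∧ adj A u v then f u v else + 0

T : ∀ {n} → (Node n → Node n → ℤ) → Node n → Node n → Node n → ℤ
T x u v w = x u v - x u w - x v w

lhsI : ∀ {n} → Graph n → Graph n → (Node n → Node n → ℤ) → ℤ
lhsI G H x =
  edgeSum G (λ u v → T x (old u) (old v) new₁)
  - edgeSum H (λ u v → T x (old u) (old v) new₁)
  + (+ 2) * ΣZ (λ u → if isolated H u then x (old u) new₁ else + 0)

lhsI' : ∀ {n} → Graph n → Graph n → (c₁ c₂ c₃ c₄ : Fin n) → (Node n → Node n → ℤ) → ℤ
lhsI' G H c₁ c₂ c₃ c₄ x =
  lhsI G H x + (d c₁ + d c₂ + d c₃ + d c₄)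
  where
  d : _ → ℤ
  d u = x (old u) new₁ - x (old u) new₂

record FourCycle {n} (G : Graph n) (c₁ c₂ c₃ c₄ : Fin n) : Set where
  field
    d12 : ¬ c₁ ≡ c₂
    d13 : ¬ c₁ ≡ c₃
    d14 : ¬ c₁ ≡ c₄
    d23 : ¬ c₂ ≡ c₃
    d24 : ¬ c₂ ≡ c₄
    d34 : ¬ c₃ ≡ c₄
    e12 : adj G c₁ c₂ ≡ true
    e23 : adj G c₂ c₃ ≡ true
    e34 : adj G c₃ c₄ ≡ true
    e41 : adj G c₄ c₁ ≡ true

inC : ∀ {n} → (c₁ c₂ c₃ c₄ : Fin n) → Fin n → Set
inC c₁ c₂ c₃ c₄ u = u ≡ c₁ ⊎ u ≡ c₂ ⊎ u ≡ c₃ ⊎ u ≡ c₄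

countC : ∀ {n} → (Node n → Bool) → (c₁ c₂ c₃ c₄ : Fin n) → ℕ
countC S c₁ c₂ c₃ c₄ = b c₁ Data.Nat.+ b c₂ Data.Nat.+ b c₃ Data.Nat.+ b c₄
  where
  b : _ → ℕ
  b u = if S (old u) then 1 else 0

{-# OPTIONS --safe #-}
module Submission where

-- For n+1 ∉ S we have T(u,v;n+1) = -2 [u ∈ S][v ∈ S] on δ(S), so I(G,H) evaluated at
-- δ(S) is -2 e_G(S) + 2 (e_H(S) + i_H(S)), where e_A(S) counts the edges of A inside S and i_H(S)
-- the single-node components inside S. The extra terms of I'(G,H,C) add 0 when n+2 ∉ S and
-- 2 |S ∩ V_C| - 4 when n+2 ∈ S; this settles (i) and (ii). For (iii), the nodes of C lie in four
-- distinct components (adjacent ones because E has no edge inside a component, opposite ones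
-- because otherwise two edges would join their component to that of a common neighbour), so
-- |S ∩ V_C| = 3. A union of m components contains exactly one G-edge per pair of them, and giving
-- each node the weight 2 / |V_i| shows e_H + i_H = m; hence I(G,H) at δ(S) is m (3 - m) = 0 for
-- m = 3, and I'(G,H,C) at δ(S) is 0 + 6 - 4 = 2.

open import Defs
open import Data.Nat using (ℕ; _≤_)
open import Data.Fin using (Fin; zero; suc)
open import Data.Bool using (Bool; true; false; _∨_; if_then_else_; _∧_; _xor_; not)
open import Data.Integer using (ℤ; +_; _+_; _-_; _*_; -_)
open import Data.Product using (_×_; ∃-syntax; _,_; proj₁; proj₂)
open import Data.Sum using (_⊎_; inj₁; inj₂)
open import Relation.Nullary using (¬_; does; yes; no; contradiction)
open import Relation.Binary.PropositionalEquality
  using (_≡_; _≢_; _≗_; refl; sym; trans; subst; cong; cong₂; module ≡-Reasoning)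

import Data.Nat as ℕ
import Data.Nat.Properties as ℕ
import Data.Nat.Tactic.RingSolver as ℕ-Solver
open import Data.Fin.Patterns using (0F; 1F; 2F; 3F)
open import Data.Fin.Properties using (_≟_; _<?_; <-cmp; <-asym; suc-injective)
open import Data.Bool.Properties using (∨-identityʳ; ∨-zeroʳ; ∨-conicalˡ; ∨-conicalʳ)
open import Data.Integer.Properties
  using ( +-*-semiring; pos-+; +-identityˡ; +-identityʳ; +-inverseʳ
        ; *-identityˡ; *-identityʳ; *-zeroʳ; *-comm; *-distribʳ-+ )
open import Data.Integer.Tactic.RingSolver using (solve-∀)
open import Algebra.Properties.Semiring.Sum +-*-semiring
  using (sum; sum-cong-≗; sum-replicate-zero; ∑-distrib-+; ∑-comm; *-distribˡ-sum; *-distribʳ-sum)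
open import Data.Vec.Functional using (_∷_; [])
open import Function using (_∘_; flip)
open import Relation.Nullary.Decidable using (dec-true; dec-false)
open import Relation.Binary.Definitions using (tri<; tri≈; tri>)

open ≡-Reasoning

χ : Bool → ℤ
χ b = if b then + 1 else + 0

χ-∧ : ∀ x y → χ (x ∧ y) ≡ χ x * χ y
χ-∧ true  y = sym (*-identityˡ (χ y))
χ-∧ false y = refl

χ-* : ∀ b z → χ b * z ≡ (if b then z else + 0)
χ-* true  z = *-identityˡ z
χ-* false z = refl

χ-xor : ∀ x y → χ (x xor y) - χ x - χ y ≡ - + 2 * (χ x * χ y)
χ-xor true  true  = refl
χ-xor true  false = refl
χ-xor false true  = refl
χ-xor false false = refl

pos-χ : ∀ b → + (if b then 1 else 0) ≡ χ b
pos-χ true  = refl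
pos-χ false = refl

ΣZ≡sum : ∀ {n} (f : Fin n → ℤ) → ΣZ f ≡ sum f
ΣZ≡sum {ℕ.zero}  f = refl
ΣZ≡sum {ℕ.suc n} f = cong (_+_ (f zero)) (ΣZ≡sum (f ∘ suc))

ΣZ-cong : ∀ {n} {f g : Fin n → ℤ} → f ≗ g → ΣZ f ≡ ΣZ g
ΣZ-cong {f = f} {g} f≗g = trans (ΣZ≡sum f) (trans (sum-cong-≗ f≗g) (sym (ΣZ≡sum g)))

ΣZ-zero : ∀ {n} {f : Fin n → ℤ} → (∀ i → f i ≡ + 0) → ΣZ f ≡ + 0
ΣZ-zero {n} f≗0 = trans (ΣZ-cong f≗0) (trans (ΣZ≡sum {n} (λ _ → + 0)) (sum-replicate-zero n))

ΣZ-distrib-+ : ∀ {n} (f g : Fin n → ℤ) → ΣZ (λ i → f i + g i) ≡ ΣZ f + ΣZ g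
ΣZ-distrib-+ f g = trans (ΣZ≡sum (λ i → f i + g i))
  (trans (∑-distrib-+ f g) (sym (cong₂ _+_ (ΣZ≡sum f) (ΣZ≡sum g))))

ΣZ-comm : ∀ {m n} (f : Fin m → Fin n → ℤ) →
          ΣZ (λ i → ΣZ (f i)) ≡ ΣZ (λ j → ΣZ (λ i → f i j))
ΣZ-comm f = trans (ΣZ²≡sum² f) (trans (∑-comm f) (sym (ΣZ²≡sum² (flip f))))
  where
  ΣZ²≡sum² : ∀ {m n} (g : Fin m → Fin n → ℤ) → ΣZ (λ i → ΣZ (g i)) ≡ sum (λ i → sum (g i))
  ΣZ²≡sum² g = trans (ΣZ-cong (ΣZ≡sum ∘ g)) (ΣZ≡sum (λ i → sum (g i)))

*-distribˡ-ΣZ : ∀ {n} c (f : Fin n → ℤ) → c * ΣZ f ≡ ΣZ (λ i → c * f i)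
*-distribˡ-ΣZ c f = trans (cong (c *_) (ΣZ≡sum f))
  (trans (*-distribˡ-sum c f) (sym (ΣZ≡sum (λ i → c * f i))))

*-distribʳ-ΣZ : ∀ {n} c (f : Fin n → ℤ) → ΣZ f * c ≡ ΣZ (λ i → f i * c)
*-distribʳ-ΣZ c f = trans (cong (_* c) (ΣZ≡sum f))
  (trans (*-distribʳ-sum c f) (sym (ΣZ≡sum (λ i → f i * c))))

ΣZ²-comm : ∀ {k l m n} (f : Fin k → Fin l → Fin m → Fin n → ℤ) →
           ΣZ (λ u → ΣZ (λ v → ΣZ (λ i → ΣZ (f u v i)))) ≡
           ΣZ (λ i → ΣZ (λ j → ΣZ (λ u → ΣZ (λ v → f u v i j))))
ΣZ²-comm f = begin
  ΣZ (λ u → ΣZ (λ v → ΣZ (λ i → ΣZ (f u v i))))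
    ≡⟨ ΣZ-cong (λ u → ΣZ-comm (λ v i → ΣZ (f u v i))) ⟩
  ΣZ (λ u → ΣZ (λ i → ΣZ (λ v → ΣZ (f u v i))))
    ≡⟨ ΣZ-cong (λ u → ΣZ-cong (λ i → ΣZ-comm (λ v → f u v i))) ⟩
  ΣZ (λ u → ΣZ (λ i → ΣZ (λ j → ΣZ (λ v → f u v i j))))
    ≡⟨ ΣZ-comm (λ u i → ΣZ (λ j → ΣZ (λ v → f u v i j))) ⟩
  ΣZ (λ i → ΣZ (λ u → ΣZ (λ j → ΣZ (λ v → f u v i j))))
    ≡⟨ ΣZ-cong (λ i → ΣZ-comm (λ u j → ΣZ (λ v → f u v i j))) ⟩
  ΣZ (λ i → ΣZ (λ j → ΣZ (λ u → ΣZ (λ v → f u v i j))))  ∎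

ΣZ-sub : ∀ {n} (f g : Fin n → ℤ) → ΣZ (λ i → f i - g i) ≡ ΣZ f - ΣZ g
ΣZ-sub {ℕ.zero}  f g = refl
ΣZ-sub {ℕ.suc n} f g =
  trans (cong (_+_ (f zero - g zero)) (ΣZ-sub (f ∘ suc) (g ∘ suc))) (interchange (f zero) (g zero) _ _)
  where
  interchange : ∀ a b c d → a - b + (c - d) ≡ a + c - (b + d)
  interchange = solve-∀

ΣZ-const : ∀ m c → ΣZ {m} (λ _ → c) ≡ + m * c
ΣZ-const ℕ.zero    c = refl
ΣZ-const (ℕ.suc m) c = begin
  c + ΣZ {m} (λ _ → c)  ≡⟨ cong (_+_ c) (ΣZ-const m c) ⟩
  c + + m * c           ≡⟨ cong (λ x → x + + m * c) (*-identityˡ c) ⟨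
  + 1 * c + + m * c     ≡⟨ *-distribʳ-+ c (+ 1) (+ m) ⟨
  + ℕ.suc m * c         ∎

ΣZ-δ : ∀ {n} (w : Fin n) (g : Fin n → ℤ) → ΣZ (λ u → χ (does (w ≟ u)) * g u) ≡ g w
ΣZ-δ {ℕ.suc n} zero    g =
  trans (cong₂ _+_ (*-identityˡ (g zero)) (ΣZ-zero {n} (λ _ → refl))) (+-identityʳ (g zero))
ΣZ-δ {ℕ.suc n} (suc w) g = trans (+-identityˡ _) (ΣZ-δ w (g ∘ suc))

ΣZ-off-diagonal : ∀ m (i : Fin m) → ΣZ (λ j → + 1 - χ (does (i ≟ j))) ≡ + m - + 1
ΣZ-off-diagonal m i = begin
  ΣZ (λ j → + 1 - δ j)                       ≡⟨ ΣZ-cong (λ j → cong (_-_ (+ 1)) (sym (*-identityʳ (δ j)))) ⟩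
  ΣZ (λ j → + 1 - δ j * + 1)                 ≡⟨ ΣZ-sub (λ _ → + 1) (λ j → δ j * + 1) ⟩
  ΣZ {m} (λ _ → + 1) - ΣZ (λ j → δ j * + 1)  ≡⟨ cong₂ _-_ (ΣZ-const m (+ 1)) (ΣZ-δ i (λ _ → + 1)) ⟩
  + m * + 1 - + 1                            ≡⟨ cong (λ k → k - + 1) (*-identityʳ (+ m)) ⟩
  + m - + 1                                  ∎
  where
  δ : Fin m → ℤ
  δ j = χ (does (i ≟ j))

pos-ΣN : ∀ {n} (f : Fin n → ℕ) → + ΣN f ≡ ΣZ (λ i → + f i)
pos-ΣN {ℕ.zero}  f = refl
pos-ΣN {ℕ.suc n} f = trans (pos-+ (f zero) _) (cong (_+_ (+ f zero)) (pos-ΣN (f ∘ suc)))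

ΣN-≥-term : ∀ {n} (f : Fin n → ℕ) i → f i ≤ ΣN f
ΣN-≥-term f zero    = ℕ.m≤m+n (f zero) _
ΣN-≥-term f (suc i) = ℕ.≤-trans (ΣN-≥-term (f ∘ suc) i) (ℕ.m≤n+m _ (f zero))

ΣN-≥-pair : ∀ {n} (f : Fin n → ℕ) {i j} → i ≢ j → f i ℕ.+ f j ≤ ΣN f
ΣN-≥-pair f {zero}  {zero}  0≢0 = contradiction refl 0≢0
ΣN-≥-pair f {zero}  {suc j} _   = ℕ.+-monoʳ-≤ (f zero) (ΣN-≥-term (f ∘ suc) j)
ΣN-≥-pair f {suc i} {zero}  _   rewrite ℕ.+-comm (f (suc i)) (f zero) =
  ℕ.+-monoʳ-≤ (f zero) (ΣN-≥-term (f ∘ suc) i)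
ΣN-≥-pair f {suc i} {suc j} i≢j =
  ℕ.≤-trans (ΣN-≥-pair (f ∘ suc) (i≢j ∘ cong suc)) (ℕ.m≤n+m _ (f zero))

anyF-witness : ∀ {m} (f : Fin m → Bool) → anyF f ≡ true → ∃[ i ] f i ≡ true
anyF-witness {ℕ.suc m} f any-f with f zero in f₀
... | true  = zero , f₀
... | false with anyF-witness (f ∘ suc) any-f
...   | i , fi = suc i , fi

anyF-false : ∀ {m} (f : Fin m → Bool) → anyF f ≡ false → ∀ i → f i ≡ false
anyF-false f none zero    = ∨-conicalˡ _ _ none
anyF-false f none (suc i) = anyF-false (f ∘ suc) (∨-conicalʳ _ _ none) i

χ-anyF : ∀ {m} (f : Fin m → Bool) → (∀ i j → f i ≡ true → f j ≡ true → i ≡ j) →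
         χ (anyF f) ≡ ΣZ (χ ∘ f)
χ-anyF {ℕ.zero}  f _       = refl
χ-anyF {ℕ.suc m} f at-most-one with f zero in f₀
... | true  = sym (trans (cong (_+_ (+ 1)) (ΣZ-zero rest-false)) (+-identityʳ (+ 1)))
  where
  rest-false : ∀ i → χ (f (suc i)) ≡ + 0
  rest-false i with f (suc i) in fi
  ... | true  = contradiction (at-most-one zero (suc i) f₀ fi) λ ()
  ... | false = refl
... | false = trans (χ-anyF (f ∘ suc) λ i j fi fj → suc-injective (at-most-one (suc i) (suc j) fi fj))
                    (sym (+-identityˡ _))

adjSum : ∀ {n} → Graph n → (Fin n → Fin n → ℤ) → ℤ
adjSum A f = ΣZ λ u → ΣZ λ v → χ (adj A u v) * f u v

adj-sym : ∀ {n} (A : Graph n) {u v} → adj A u v ≡ true → adj A v u ≡ true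
adj-sym A {u} {v} uv = trans (symmetric A v u) uv

edgeSum-cong : ∀ {n} (A : Graph n) {f g : Fin n → Fin n → ℤ} →
               (∀ u v → f u v ≡ g u v) → edgeSum A f ≡ edgeSum A g
edgeSum-cong A f≗g = ΣZ-cong λ u → ΣZ-cong λ v →
  cong (λ z → if does (u <? v) ∧ adj A u v then z else + 0) (f≗g u v)

edgeSum-*ˡ : ∀ {n} (A : Graph n) c (f : Fin n → Fin n → ℤ) →
             edgeSum A (λ u v → c * f u v) ≡ c * edgeSum A f
edgeSum-*ˡ {n} A c f = sym (trans (*-distribˡ-ΣZ c (ΣZ ∘ term)) (ΣZ-cong λ u →
  trans (*-distribˡ-ΣZ c (term u)) (ΣZ-cong λ v → *-if (does (u <? v) ∧ adj A u v) (f u v))))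
  where
  term : Fin n → Fin n → ℤ
  term u v = if does (u <? v) ∧ adj A u v then f u v else + 0
  *-if : ∀ b z → c * (if b then z else + 0) ≡ (if b then c * z else + 0)
  *-if true  z = refl
  *-if false z = *-zeroʳ c

adjSum-symmetric : ∀ {n} (A : Graph n) (f : Fin n → Fin n → ℤ) → (∀ u v → f u v ≡ f v u) →
                   adjSum A f ≡ edgeSum A f + edgeSum A f
adjSum-symmetric {n} A f f-sym = begin
  adjSum A f                                   ≡⟨ ΣZ-cong (λ u → ΣZ-cong (split u)) ⟩
  ΣZ (λ u → ΣZ (λ v → e u v + e v u))          ≡⟨ ΣZ-cong (λ u → ΣZ-distrib-+ (e u) (flip e u)) ⟩
  ΣZ (λ u → ΣZ (e u) + ΣZ (λ v → e v u))       ≡⟨ ΣZ-distrib-+ (ΣZ ∘ e) (λ u → ΣZ (flip e u)) ⟩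
  edgeSum A f + ΣZ (λ u → ΣZ (λ v → e v u))    ≡⟨ cong (_+_ (edgeSum A f)) (ΣZ-comm (flip e)) ⟩
  edgeSum A f + edgeSum A f                    ∎
  where
  e : Fin n → Fin n → ℤ
  e u v = if does (u <? v) ∧ adj A u v then f u v else + 0
  split : ∀ u v → χ (adj A u v) * f u v ≡ e u v + e v u
  split u v with <-cmp u v
  ... | tri< u<v _ _ rewrite dec-true (u <? v) u<v | dec-false (v <? u) (<-asym u<v) =
    trans (χ-* (adj A u v) (f u v)) (sym (+-identityʳ _))
  ... | tri> _ _ v<u rewrite dec-true (v <? u) v<u | dec-false (u <? v) (<-asym v<u)
                           | symmetric A u v | f-sym u v =
    trans (χ-* (adj A v u) (f v u)) (sym (+-identityˡ _))
  ... | tri≈ u≮u refl _ rewrite dec-false (u <? u) u≮u | loopless A u = refl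

both : ∀ {n} → (Fin n → Bool) → Fin n → Fin n → ℤ
both s u v = χ (s u) * χ (s v)

both-comm : ∀ {n} (s : Fin n → Bool) u v → both s u v ≡ both s v u
both-comm s u v = *-comm (χ (s u)) (χ (s v))

isolatedIn : ∀ {n} → Graph n → (Fin n → Bool) → ℤ
isolatedIn H s = ΣZ λ u → χ (isolated H u) * χ (s u)

corner : ∀ {n} → Fin n → Fin n → Fin n → Fin n → Fin 4 → Fin n
corner c₁ c₂ c₃ c₄ = c₁ ∷ c₂ ∷ c₃ ∷ c₄ ∷ []

inC→corner : ∀ {n} {c₁ c₂ c₃ c₄ x : Fin n} → inC c₁ c₂ c₃ c₄ x →
             ∃[ k ] x ≡ corner c₁ c₂ c₃ c₄ k
inC→corner (inj₁ x≡c₁)               = 0F , x≡c₁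
inC→corner (inj₂ (inj₁ x≡c₂))        = 1F , x≡c₂
inC→corner (inj₂ (inj₂ (inj₁ x≡c₃))) = 2F , x≡c₃
inC→corner (inj₂ (inj₂ (inj₂ x≡c₄))) = 3F , x≡c₄

countC-as-ΣZ : ∀ {n} (S : Node n → Bool) c₁ c₂ c₃ c₄ →
               + countC S c₁ c₂ c₃ c₄ ≡ ΣZ (λ k → χ (S (old (corner c₁ c₂ c₃ c₄ k))))
countC-as-ΣZ {n} S c₁ c₂ c₃ c₄ = begin
  + countC S c₁ c₂ c₃ c₄          ≡⟨ cong +_ (reassoc (b c₁) (b c₂) (b c₃) (b c₄)) ⟩
  + ΣN (b ∘ c)                    ≡⟨ pos-ΣN (b ∘ c) ⟩
  ΣZ (λ k → + b (c k))            ≡⟨ ΣZ-cong (λ k → pos-χ (S (old (c k)))) ⟩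
  ΣZ (λ k → χ (S (old (c k))))    ∎
  where
  c : Fin 4 → Fin n
  c = corner c₁ c₂ c₃ c₄
  b : Fin n → ℕ
  b u = if S (old u) then 1 else 0
  reassoc : ∀ w x y z → w ℕ.+ x ℕ.+ y ℕ.+ z ≡ w ℕ.+ (x ℕ.+ (y ℕ.+ (z ℕ.+ 0)))
  reassoc = ℕ-Solver.solve-∀

module _ {n} (S : Node n → Bool) where

  cut-outside : ∀ {w} → S w ≡ false → ∀ u → cut S u w ≡ χ (S u)
  cut-outside w∉S u rewrite w∉S with S u
  ... | true  = refl
  ... | false = refl

  cut-inside : ∀ {w} → S w ≡ true → ∀ u → cut S u w ≡ + 1 - χ (S u)
  cut-inside w∈S u rewrite w∈S with S u
  ... | true  = refl
  ... | false = refl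

  T-cut : ∀ {w} → S w ≡ false → ∀ u v → T (cut S) u v w ≡ - + 2 * (χ (S u) * χ (S v))
  T-cut w∉S u v = trans (cong₂ (λ x y → cut S u v - x - y) (cut-outside w∉S u) (cut-outside w∉S v))
                        (χ-xor (S u) (S v))

  lhsI-cut : ∀ (G H : Graph n) → S new₁ ≡ false →
             lhsI G H (cut S) ≡
             - adjSum G (both (S ∘ old)) + (adjSum H (both (S ∘ old)) + + 2 * isolatedIn H (S ∘ old))
  lhsI-cut G H n+1∉S = begin
    lhsI G H (cut S)
      ≡⟨ cong₂ _+_ (cong₂ _-_ (edge-terms G) (edge-terms H)) (cong (+ 2 *_) (ΣZ-cong isolated-term)) ⟩
    - + 2 * e G - - + 2 * e H + + 2 * isolatedIn H s
      ≡⟨ rearrange (e G) (e H) (isolatedIn H s) ⟩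
    - (e G + e G) + ((e H + e H) + + 2 * isolatedIn H s)
      ≡⟨ cong₂ (λ g h → - g + (h + + 2 * isolatedIn H s)) (pairs G) (pairs H) ⟨
    - adjSum G (both s) + (adjSum H (both s) + + 2 * isolatedIn H s)  ∎
    where
    s : Fin n → Bool
    s = S ∘ old
    e : Graph n → ℤ
    e A = edgeSum A (both s)
    edge-terms : ∀ A → edgeSum A (λ u v → T (cut S) (old u) (old v) new₁) ≡ - + 2 * e A
    edge-terms A = trans (edgeSum-cong A (λ u v → T-cut n+1∉S (old u) (old v))) (edgeSum-*ˡ A (- + 2) (both s))
    isolated-term : ∀ u → (if isolated H u then cut S (old u) new₁ else + 0) ≡ χ (isolated H u) * χ (s u)
    isolated-term u = trans (cong (λ z → if isolated H u then z else + 0) (cut-outside n+1∉S (old u)))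
                            (sym (χ-* (isolated H u) (χ (s u))))
    pairs : ∀ A → adjSum A (both s) ≡ e A + e A
    pairs A = adjSum-symmetric A (both s) (both-comm s)
    rearrange : ∀ g h z → - + 2 * g - - + 2 * h + + 2 * z ≡ - (g + g) + ((h + h) + + 2 * z)
    rearrange = solve-∀

  lhsI-removeNew₂ : ∀ (G H : Graph n) → lhsI G H (cut (removeNew₂ S)) ≡ lhsI G H (cut S)
  lhsI-removeNew₂ G H = refl

  lhsI'-cut-new₂∉ : ∀ (G H : Graph n) c₁ c₂ c₃ c₄ → S new₁ ≡ false → S new₂ ≡ false →
                    lhsI' G H c₁ c₂ c₃ c₄ (cut S) ≡ lhsI G H (cut S)
  lhsI'-cut-new₂∉ G H c₁ c₂ c₃ c₄ n+1∉S n+2∉S = trans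
    (cong (_+_ (lhsI G H (cut S)))
          (cong₂ _+_ (cong₂ _+_ (cong₂ _+_ (d≡0 c₁) (d≡0 c₂)) (d≡0 c₃)) (d≡0 c₄)))
    (+-identityʳ _)
    where
    d≡0 : ∀ u → cut S (old u) new₁ - cut S (old u) new₂ ≡ + 0
    d≡0 u = trans (cong₂ _-_ (cut-outside n+1∉S (old u)) (cut-outside n+2∉S (old u)))
                  (+-inverseʳ (χ (S (old u))))

  lhsI'-cut-new₂∈ : ∀ (G H : Graph n) c₁ c₂ c₃ c₄ → S new₁ ≡ false → S new₂ ≡ true →
                    lhsI' G H c₁ c₂ c₃ c₄ (cut S) ≡
                    lhsI G H (cut S) + (+ 2 * + countC S c₁ c₂ c₃ c₄ - + 4)
  lhsI'-cut-new₂∈ G H c₁ c₂ c₃ c₄ n+1∉S n+2∈S = trans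
    (cong (_+_ L) (cong₂ _+_ (cong₂ _+_ (cong₂ _+_ (d≡ c₁) (d≡ c₂)) (d≡ c₃)) (d≡ c₄)))
    (trans (rearrange L (x c₁) (x c₂) (x c₃) (x c₄))
           (cong (λ k → L + (+ 2 * k - + 4)) (sym (countC-as-ΣZ S c₁ c₂ c₃ c₄))))
    where
    L : ℤ
    L = lhsI G H (cut S)
    x : Fin n → ℤ
    x u = χ (S (old u))
    d≡ : ∀ u → cut S (old u) new₁ - cut S (old u) new₂ ≡ x u - (+ 1 - x u)
    d≡ u = cong₂ _-_ (cut-outside n+1∉S (old u)) (cut-inside n+2∈S (old u))
    rearrange : ∀ L a b c d →
      L + ((a - (+ 1 - a)) + (b - (+ 1 - b)) + (c - (+ 1 - c)) + (d - (+ 1 - d))) ≡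
      L + (+ 2 * (a + (b + (c + (d + + 0)))) - + 4)
    rearrange = solve-∀

module Components {n} (H : Graph n) where

  SameComp-sym : ∀ {u v} → SameComp H u v → SameComp H v u
  SameComp-sym (inj₁ u≡v) = inj₁ (sym u≡v)
  SameComp-sym (inj₂ uv)  = inj₂ (adj-sym H uv)

  sameCompᵇ-sound : ∀ {u v} → sameCompᵇ H u v ≡ true → SameComp H u v
  sameCompᵇ-sound {u} {v} p with u ≟ v
  ... | yes u≡v = inj₁ u≡v
  ... | no  _   = inj₂ p

  sameCompᵇ-complete : ∀ {u v} → SameComp H u v → sameCompᵇ H u v ≡ true
  sameCompᵇ-complete {u} (inj₁ refl) rewrite dec-true (u ≟ u) refl = refl
  sameCompᵇ-complete     (inj₂ uv)   rewrite uv = ∨-zeroʳ _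

  sameCompᵇ-false : ∀ {u v} → ¬ SameComp H u v → sameCompᵇ H u v ≡ false
  sameCompᵇ-false {u} {v} u≁v with u ≟ v | adj H u v
  ... | yes u≡v | _     = contradiction (inj₁ u≡v) u≁v
  ... | no  _   | true  = contradiction (inj₂ refl) u≁v
  ... | no  _   | false = refl

  χ-sameCompᵇ : ∀ b u → χ (sameCompᵇ H b u) ≡ χ (does (b ≟ u)) + χ (adj H b u)
  χ-sameCompᵇ b u with b ≟ u
  ... | yes refl rewrite loopless H b = refl
  ... | no  _    = sym (+-identityˡ _)

  module _ {p} (c : Fin p → Fin n) (c-separated : ∀ k l → k ≢ l → ¬ SameComp H (c k) (c l)) where

    sameCompᵇ-separated : ∀ k l → sameCompᵇ H (c k) (c l) ≡ does (k ≟ l)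
    sameCompᵇ-separated k l with k ≟ l
    ... | yes refl = sameCompᵇ-complete (inj₁ refl)
    ... | no  k≢l  = sameCompᵇ-false (c-separated k l k≢l)

    separated-meets-once : ∀ l → ΣZ (λ k → χ (sameCompᵇ H (c l) (c k))) ≡ + 1
    separated-meets-once l =
      trans (ΣZ-cong (λ k → trans (cong χ (sameCompᵇ-separated l k)) (sym (*-identityʳ _))))
            (ΣZ-δ l (λ _ → + 1))

  module Matching (M : IsMatching H) where

    SameComp-trans : ∀ {u v w} → SameComp H u v → SameComp H v w → SameComp H u w
    SameComp-trans (inj₁ refl) vw          = vw
    SameComp-trans (inj₂ uv)   (inj₁ refl) = inj₂ uv
    SameComp-trans (inj₂ uv)   (inj₂ vw)   = inj₁ (M _ _ _ (adj-sym H uv) vw)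

    sameCompᵇ-resp-adj : ∀ b {u v} → adj H u v ≡ true → sameCompᵇ H b u ≡ sameCompᵇ H b v
    sameCompᵇ-resp-adj b {u} {v} uv with sameCompᵇ H b u in b~u | sameCompᵇ H b v in b~v
    ... | true  | true  = refl
    ... | false | false = refl
    ... | true  | false = contradiction
      (trans (sym (sameCompᵇ-complete (SameComp-trans (sameCompᵇ-sound b~u) (inj₂ uv)))) b~v) λ ()
    ... | false | true  = contradiction
      (trans (sym (sameCompᵇ-complete (SameComp-trans (sameCompᵇ-sound b~v) (inj₂ (adj-sym H uv))))) b~u) λ ()

    data Partner (u : Fin n) : Set where
      unmatched : isolated H u ≡ true → (∀ v → adj H u v ≡ false) → Partner u
      matched   : ∀ p → isolated H u ≡ false → (∀ v → adj H u v ≡ does (p ≟ v)) → Partner u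

    partner : ∀ u → Partner u
    partner u with anyF (adj H u) in any-u
    ... | false = unmatched (cong not any-u) (anyF-false (adj H u) any-u)
    ... | true with anyF-witness (adj H u) any-u
    ...   | p , up = matched p (cong not any-u) adj≡δ
      where
      adj≡δ : ∀ v → adj H u v ≡ does (p ≟ v)
      adj≡δ v with p ≟ v
      ... | yes refl = up
      ... | no  p≢v with adj H u v in uv
      ...   | true  = contradiction (M u p v up uv) p≢v
      ...   | false = refl

    partner-not-isolated : ∀ {u p} → (∀ v → adj H u v ≡ does (p ≟ v)) → isolated H p ≡ false
    partner-not-isolated {u} {p} adj≡δ with partner p
    ... | matched _ p-paired _ = p-paired
    ... | unmatched _ p-alone  =
      contradiction (trans (sym (p-alone u)) (adj-sym H (trans (adj≡δ p) (dec-true (p ≟ p) refl)))) λ ()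

    degree : ∀ u → ΣZ (λ v → χ (adj H u v)) ≡ + 1 - χ (isolated H u)
    degree u with partner u
    ... | unmatched alone none = trans (ΣZ-zero (λ v → cong χ (none v))) (cong (λ b → + 1 - χ b) (sym alone))
    ... | matched p paired adj≡δ = begin
      ΣZ (λ v → χ (adj H u v))           ≡⟨ ΣZ-cong (λ v → trans (cong χ (adj≡δ v)) (sym (*-identityʳ _))) ⟩
      ΣZ (λ v → χ (does (p ≟ v)) * + 1)  ≡⟨ ΣZ-δ p (λ _ → + 1) ⟩
      + 1 - χ false                      ≡⟨ cong (λ b → + 1 - χ b) paired ⟨
      + 1 - χ (isolated H u)             ∎

    -- 2 / |component of u|
    weight : Fin n → ℤ
    weight u = + 1 + χ (isolated H u)

    component-weight : ∀ b → ΣZ (λ u → χ (sameCompᵇ H b u) * weight u) ≡ + 2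
    component-weight b = begin
      ΣZ (λ u → χ (sameCompᵇ H b u) * weight u)
        ≡⟨ ΣZ-cong (λ u → trans (cong (_* weight u) (χ-sameCompᵇ b u))
                                (*-distribʳ-+ (weight u) (χ (does (b ≟ u))) (χ (adj H b u)))) ⟩
      ΣZ (λ u → χ (does (b ≟ u)) * weight u + χ (adj H b u) * weight u)
        ≡⟨ ΣZ-distrib-+ (λ u → χ (does (b ≟ u)) * weight u) (λ u → χ (adj H b u) * weight u) ⟩
      ΣZ (λ u → χ (does (b ≟ u)) * weight u) + ΣZ (λ u → χ (adj H b u) * weight u)
        ≡⟨ cong (λ w → w + ΣZ (λ u → χ (adj H b u) * weight u)) (ΣZ-δ b weight) ⟩
      weight b + ΣZ (λ u → χ (adj H b u) * weight u)
        ≡⟨ by-partner (partner b) ⟩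
      + 2 ∎
      where
      by-partner : Partner b → weight b + ΣZ (λ u → χ (adj H b u) * weight u) ≡ + 2
      by-partner (unmatched alone none) =
        cong₂ (λ i z → + 1 + χ i + z) alone (ΣZ-zero (λ u → cong (λ a → χ a * weight u) (none u)))
      by-partner (matched p paired adj≡δ) =
        cong₂ (λ i z → + 1 + χ i + z) paired
          (trans (ΣZ-cong (λ u → cong (λ a → χ a * weight u) (adj≡δ u)))
                 (trans (ΣZ-δ p weight) (cong (λ i → + 1 + χ i) (partner-not-isolated adj≡δ))))

edgesBetween-as-ΣZ : ∀ {n} (G H : Graph n) b c → + edgesBetween G H b c ≡
  ΣZ (λ u → ΣZ (λ v → χ (sameCompᵇ H b u) * (χ (sameCompᵇ H c v) * χ (adj G u v))))
edgesBetween-as-ΣZ {n} G H b c =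
  trans (pos-ΣN (λ u → ΣN (counts u))) (ΣZ-cong λ u → trans (pos-ΣN (counts u)) (ΣZ-cong λ v →
    trans (pos-χ (b~ u ∧ (c~ v ∧ adj G u v)))
          (trans (χ-∧ (b~ u) _) (cong (χ (b~ u) *_) (χ-∧ (c~ v) (adj G u v))))))
  where
  b~ c~ : Fin n → Bool
  b~ u = sameCompᵇ H b u
  c~ v = sameCompᵇ H c v
  counts : Fin n → Fin n → ℕ
  counts u v = if b~ u ∧ (c~ v ∧ adj G u v) then 1 else 0

module _ {n} {G H : Graph n} (M : IsMatching H) (CC : ComponentCondition G H) where

  open Components H
  open Matching M

  edgesBetween-components : ∀ b c → + edgesBetween G H b c ≡ + 1 - χ (sameCompᵇ H b c)
  edgesBetween-components b c with sameCompᵇ H b c in b~c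
  ... | false = cong +_ (proj₂ CC b c λ b≈c →
                  contradiction (trans (sym (sameCompᵇ-complete b≈c)) b~c) λ ())
  ... | true  = trans (edgesBetween-as-ΣZ G H b c) (ΣZ-zero λ u → ΣZ-zero λ v → no-inner-edge u v)
    where
    no-inner-edge : ∀ u v → χ (sameCompᵇ H b u) * (χ (sameCompᵇ H c v) * χ (adj G u v)) ≡ + 0
    no-inner-edge u v with sameCompᵇ H b u in b~u | sameCompᵇ H c v in c~v | adj G u v in uv
    ... | false | _     | _     = refl
    ... | true  | false | _     = refl
    ... | true  | true  | false = refl
    ... | true  | true  | true  = contradiction
      (SameComp-trans (SameComp-sym (sameCompᵇ-sound b~u))
                      (SameComp-trans (sameCompᵇ-sound b~c) (sameCompᵇ-sound c~v)))
      (proj₁ CC u v uv)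

  common-neighbour-separates : ∀ {x y z} → x ≢ z → adj G x y ≡ true → adj G z y ≡ true →
                               ¬ SameComp H x z
  common-neighbour-separates {x} {y} {z} x≢z xy zy x~z =
    ℕ.<-irrefl refl (subst (2 ≤_) (proj₂ CC x y (proj₁ CC x y xy))
      (ℕ.≤-trans (ℕ.+-mono-≤ (counted (inj₁ refl) xy) (counted x~z zy)) (ΣN-≥-pair (ΣN ∘ row) x≢z)))
    where
    row : Fin n → Fin n → ℕ
    row a b = if sameCompᵇ H x a ∧ sameCompᵇ H y b ∧ adj G a b then 1 else 0
    one : ∀ {p q r} → p ≡ true → q ≡ true → r ≡ true → (if p ∧ q ∧ r then 1 else 0) ≡ 1
    one refl refl refl = refl
    counted : ∀ {a} → SameComp H x a → adj G a y ≡ true → 1 ≤ ΣN (row a)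
    counted {a} x~a ay = ℕ.≤-trans
      (ℕ.≤-reflexive (sym (one (sameCompᵇ-complete x~a) (sameCompᵇ-complete (inj₁ refl)) ay)))
      (ΣN-≥-term (row a) y)

  corners-separated : ∀ {c₁ c₂ c₃ c₄} → FourCycle G c₁ c₂ c₃ c₄ →
                      ∀ k l → k ≢ l → ¬ SameComp H (corner c₁ c₂ c₃ c₄ k) (corner c₁ c₂ c₃ c₄ l)
  corners-separated C 0F 0F 0≢0 = contradiction refl 0≢0
  corners-separated C 1F 1F 1≢1 = contradiction refl 1≢1
  corners-separated C 2F 2F 2≢2 = contradiction refl 2≢2
  corners-separated C 3F 3F 3≢3 = contradiction refl 3≢3
  corners-separated C 0F 1F _   = proj₁ CC _ _ (FourCycle.e12 C)
  corners-separated C 1F 2F _   = proj₁ CC _ _ (FourCycle.e23 C)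
  corners-separated C 2F 3F _   = proj₁ CC _ _ (FourCycle.e34 C)
  corners-separated C 0F 3F _   = proj₁ CC _ _ (adj-sym G (FourCycle.e41 C))
  corners-separated C 0F 2F _   =
    common-neighbour-separates (FourCycle.d13 C) (FourCycle.e12 C) (adj-sym G (FourCycle.e23 C))
  corners-separated C 1F 3F _   =
    common-neighbour-separates (FourCycle.d24 C) (FourCycle.e23 C) (adj-sym G (FourCycle.e34 C))
  corners-separated C 1F 0F 1≢0 = corners-separated C 0F 1F (1≢0 ∘ sym) ∘ SameComp-sym
  corners-separated C 2F 0F 2≢0 = corners-separated C 0F 2F (2≢0 ∘ sym) ∘ SameComp-sym
  corners-separated C 3F 0F 3≢0 = corners-separated C 0F 3F (3≢0 ∘ sym) ∘ SameComp-sym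
  corners-separated C 2F 1F 2≢1 = corners-separated C 1F 2F (2≢1 ∘ sym) ∘ SameComp-sym
  corners-separated C 3F 1F 3≢1 = corners-separated C 1F 3F (3≢1 ∘ sym) ∘ SameComp-sym
  corners-separated C 3F 2F 3≢2 = corners-separated C 2F 3F (3≢2 ∘ sym) ∘ SameComp-sym

  module _ {m} (a : Fin m → Fin n) (a-separated : ∀ i j → i ≢ j → ¬ SameComp H (a i) (a j))
           (S : Node n → Bool) (S≡⋃ : ∀ u → S (old u) ≡ anyF (λ i → sameCompᵇ H (a i) u)) where

    private
      s : Fin n → Bool
      s = S ∘ old
      member : Fin m → Fin n → ℤ
      member i u = χ (sameCompᵇ H (a i) u)

    χ-union : ∀ u → χ (s u) ≡ ΣZ (λ i → member i u)
    χ-union u = trans (cong χ (S≡⋃ u)) (χ-anyF (λ i → sameCompᵇ H (a i) u) disjoint)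
      where
      disjoint : ∀ i j → sameCompᵇ H (a i) u ≡ true → sameCompᵇ H (a j) u ≡ true → i ≡ j
      disjoint i j ai~u aj~u with i ≟ j
      ... | yes i≡j = i≡j
      ... | no  i≢j = contradiction
        (SameComp-trans (sameCompᵇ-sound ai~u) (SameComp-sym (sameCompᵇ-sound aj~u))) (a-separated i j i≢j)

    χ-union-resp-adj : ∀ {u v} → adj H u v ≡ true → χ (s u) ≡ χ (s v)
    χ-union-resp-adj {u} {v} uv = begin
      χ (s u)                ≡⟨ χ-union u ⟩
      ΣZ (λ i → member i u)  ≡⟨ ΣZ-cong (λ i → cong χ (sameCompᵇ-resp-adj (a i) uv)) ⟩
      ΣZ (λ i → member i v)  ≡⟨ χ-union v ⟨
      χ (s v)                ∎

    adj-both-expand : ∀ u v → χ (adj G u v) * both s u v ≡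
                      ΣZ (λ i → ΣZ (λ j → member i u * (member j v * χ (adj G u v))))
    adj-both-expand u v = begin
      χ (adj G u v) * (χ (s u) * χ (s v))
        ≡⟨ cong₂ (λ x y → χ (adj G u v) * (x * y)) (χ-union u) (χ-union v) ⟩
      χ (adj G u v) * (ΣZ (λ i → member i u) * ΣZ (λ j → member j v))
        ≡⟨ reorder (χ (adj G u v)) (ΣZ (λ i → member i u)) (ΣZ (λ j → member j v)) ⟩
      ΣZ (λ i → member i u) * (ΣZ (λ j → member j v) * χ (adj G u v))
        ≡⟨ cong (ΣZ (λ i → member i u) *_) (*-distribʳ-ΣZ (χ (adj G u v)) (λ j → member j v)) ⟩
      ΣZ (λ i → member i u) * ΣZ (λ j → member j v * χ (adj G u v))
        ≡⟨ *-distribʳ-ΣZ _ (λ i → member i u) ⟩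
      ΣZ (λ i → member i u * ΣZ (λ j → member j v * χ (adj G u v)))
        ≡⟨ ΣZ-cong (λ i → *-distribˡ-ΣZ (member i u) (λ j → member j v * χ (adj G u v))) ⟩
      ΣZ (λ i → ΣZ (λ j → member i u * (member j v * χ (adj G u v))))  ∎
      where
      reorder : ∀ e x y → e * (x * y) ≡ x * (y * e)
      reorder = solve-∀

    edges-between-members : ∀ i j → ΣZ (λ u → ΣZ (λ v → member i u * (member j v * χ (adj G u v)))) ≡
                                    + 1 - χ (does (i ≟ j))
    edges-between-members i j = begin
      ΣZ (λ u → ΣZ (λ v → member i u * (member j v * χ (adj G u v))))
        ≡⟨ edgesBetween-as-ΣZ G H (a i) (a j) ⟨
      + edgesBetween G H (a i) (a j)
        ≡⟨ edgesBetween-components (a i) (a j) ⟩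
      + 1 - χ (sameCompᵇ H (a i) (a j))
        ≡⟨ cong (λ b → + 1 - χ b) (sameCompᵇ-separated a a-separated i j) ⟩
      + 1 - χ (does (i ≟ j))  ∎

    adjSum-G-union : adjSum G (both s) ≡ + m * (+ m - + 1)
    adjSum-G-union = begin
      adjSum G (both s)
        ≡⟨ ΣZ-cong (λ u → ΣZ-cong (adj-both-expand u)) ⟩
      ΣZ (λ u → ΣZ (λ v → ΣZ (λ i → ΣZ (λ j → member i u * (member j v * χ (adj G u v))))))
        ≡⟨ ΣZ²-comm (λ u v i j → member i u * (member j v * χ (adj G u v))) ⟩
      ΣZ (λ i → ΣZ (λ j → ΣZ (λ u → ΣZ (λ v → member i u * (member j v * χ (adj G u v))))))
        ≡⟨ ΣZ-cong (λ i → ΣZ-cong (edges-between-members i)) ⟩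
      ΣZ {m} (λ i → ΣZ {m} (λ j → + 1 - χ (does (i ≟ j))))
        ≡⟨ ΣZ-cong (ΣZ-off-diagonal m) ⟩
      ΣZ {m} (λ _ → + m - + 1)
        ≡⟨ ΣZ-const m (+ m - + 1) ⟩
      + m * (+ m - + 1)  ∎

    adj-both-row : ∀ u → ΣZ (λ v → χ (adj H u v) * both s u v) ≡ χ (s u) * (+ 1 - χ (isolated H u))
    adj-both-row u = begin
      ΣZ (λ v → χ (adj H u v) * both s u v)  ≡⟨ ΣZ-cong collapse ⟩
      ΣZ (λ v → χ (s u) * χ (adj H u v))     ≡⟨ *-distribˡ-ΣZ (χ (s u)) (λ v → χ (adj H u v)) ⟨
      χ (s u) * ΣZ (λ v → χ (adj H u v))     ≡⟨ cong (χ (s u) *_) (degree u) ⟩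
      χ (s u) * (+ 1 - χ (isolated H u))     ∎
      where
      idempotent : ∀ b → + 1 * (χ b * χ b) ≡ χ b * + 1
      idempotent true  = refl
      idempotent false = refl
      collapse : ∀ v → χ (adj H u v) * both s u v ≡ χ (s u) * χ (adj H u v)
      collapse v with adj H u v in uv
      ... | false = sym (*-zeroʳ (χ (s u)))
      ... | true  = trans (cong (λ y → + 1 * (χ (s u) * y)) (sym (χ-union-resp-adj uv))) (idempotent (s u))

    adjSum-H-union : adjSum H (both s) + + 2 * isolatedIn H s ≡ + m * + 2
    adjSum-H-union = begin
      adjSum H (both s) + + 2 * isolatedIn H s
        ≡⟨ cong₂ _+_ (ΣZ-cong adj-both-row) (*-distribˡ-ΣZ (+ 2) (λ u → χ (isolated H u) * χ (s u))) ⟩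
      ΣZ (λ u → χ (s u) * (+ 1 - χ (isolated H u))) + ΣZ (λ u → + 2 * (χ (isolated H u) * χ (s u)))
        ≡⟨ ΣZ-distrib-+ (λ u → χ (s u) * (+ 1 - χ (isolated H u)))
                        (λ u → + 2 * (χ (isolated H u) * χ (s u))) ⟨
      ΣZ (λ u → χ (s u) * (+ 1 - χ (isolated H u)) + + 2 * (χ (isolated H u) * χ (s u)))
        ≡⟨ ΣZ-cong (λ u → regroup (χ (s u)) (χ (isolated H u))) ⟩
      ΣZ (λ u → χ (s u) * weight u)
        ≡⟨ ΣZ-cong (λ u → trans (cong (_* weight u) (χ-union u))
                                (*-distribʳ-ΣZ (weight u) (λ i → member i u))) ⟩
      ΣZ (λ u → ΣZ (λ i → member i u * weight u))
        ≡⟨ ΣZ-comm (λ u i → member i u * weight u) ⟩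
      ΣZ (λ i → ΣZ (λ u → member i u * weight u))
        ≡⟨ ΣZ-cong (λ i → component-weight (a i)) ⟩
      ΣZ {m} (λ _ → + 2)
        ≡⟨ ΣZ-const m (+ 2) ⟩
      + m * + 2  ∎
      where
      regroup : ∀ x i → x * (+ 1 - i) + + 2 * (i * x) ≡ x * (+ 1 + i)
      regroup = solve-∀

    lhsI-union : S new₁ ≡ false → lhsI G H (cut S) ≡ + m * (+ 3 - + m)
    lhsI-union n+1∉S = begin
      lhsI G H (cut S)                                                  ≡⟨ lhsI-cut S G H n+1∉S ⟩
      - adjSum G (both s) + (adjSum H (both s) + + 2 * isolatedIn H s)  ≡⟨ cong₂ (λ g h → - g + h)
                                                                             adjSum-G-union adjSum-H-union ⟩
      - (+ m * (+ m - + 1)) + + m * + 2                                 ≡⟨ simplify (+ m) ⟩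
      + m * (+ 3 - + m)                                                 ∎
      where
      simplify : ∀ k → - (k * (k - + 1)) + k * + 2 ≡ k * (+ 3 - k)
      simplify = solve-∀

    union-count : ∀ {p} (c : Fin p → Fin n) → (∀ k l → k ≢ l → ¬ SameComp H (c k) (c l)) →
                  (∀ i → ∃[ l ] a i ≡ c l) → ΣZ (λ k → χ (s (c k))) ≡ + m
    union-count c c-separated a∈c = begin
      ΣZ (λ k → χ (s (c k)))                ≡⟨ ΣZ-cong (χ-union ∘ c) ⟩
      ΣZ (λ k → ΣZ (λ i → member i (c k)))  ≡⟨ ΣZ-comm (λ k i → member i (c k)) ⟩
      ΣZ (λ i → ΣZ (λ k → member i (c k)))  ≡⟨ ΣZ-cong meets-once ⟩
      ΣZ {m} (λ _ → + 1)                    ≡⟨ ΣZ-const m (+ 1) ⟩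
      + m * + 1                             ≡⟨ *-identityʳ (+ m) ⟩
      + m                                   ∎
      where
      meets-once : ∀ i → ΣZ (λ k → member i (c k)) ≡ + 1
      meets-once i with a∈c i
      ... | l , ai≡cl rewrite ai≡cl = separated-meets-once c c-separated l

proposition3 : (n : ℕ) → 1 ≤ n → (G H : Graph n) → IsMatching H → ComponentCondition G H →
    (c₁ c₂ c₃ c₄ : Fin n) → FourCycle G c₁ c₂ c₃ c₄ →
    (S : Node n → Bool) → S new₁ ≡ false →
    ((S new₂ ≡ false × lhsI G H (cut S) ≡ + 2)
     ⊎ (S new₂ ≡ true × countC S c₁ c₂ c₃ c₄ ≡ 2 × lhsI G H (cut (removeNew₂ S)) ≡ + 2)
     ⊎ (∃[ a₁ ] ∃[ a₂ ] ∃[ a₃ ] (inC c₁ c₂ c₃ c₄ a₁ × inC c₁ c₂ c₃ c₄ a₂ × inC c₁ c₂ c₃ c₄ a₃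
          × ¬ SameComp H a₁ a₂ × ¬ SameComp H a₁ a₃ × ¬ SameComp H a₂ a₃
          × S new₂ ≡ true
          × (∀ u → S (old u) ≡ (sameCompᵇ H a₁ u ∨ sameCompᵇ H a₂ u ∨ sameCompᵇ H a₃ u))))) →
    lhsI' G H c₁ c₂ c₃ c₄ (cut S) ≡ + 2
proposition3 n _ G H M CC c₁ c₂ c₃ c₄ C S n+1∉S (inj₁ (n+2∉S , tight)) =
  trans (lhsI'-cut-new₂∉ S G H c₁ c₂ c₃ c₄ n+1∉S n+2∉S) tight
proposition3 n _ G H M CC c₁ c₂ c₃ c₄ C S n+1∉S (inj₂ (inj₁ (n+2∈S , two , tight))) = begin
  lhsI' G H c₁ c₂ c₃ c₄ (cut S)
    ≡⟨ lhsI'-cut-new₂∈ S G H c₁ c₂ c₃ c₄ n+1∉S n+2∈S ⟩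
  lhsI G H (cut S) + (+ 2 * + countC S c₁ c₂ c₃ c₄ - + 4)
    ≡⟨ cong₂ (λ L k → L + (+ 2 * + k - + 4)) (trans (sym (lhsI-removeNew₂ S G H)) tight) two ⟩
  + 2  ∎
proposition3 n _ G H M CC c₁ c₂ c₃ c₄ C S n+1∉S
  (inj₂ (inj₂ (a₁ , a₂ , a₃ , a₁∈C , a₂∈C , a₃∈C , a₁≁a₂ , a₁≁a₃ , a₂≁a₃ , n+2∈S , S≡⋃))) = begin
  lhsI' G H c₁ c₂ c₃ c₄ (cut S)
    ≡⟨ lhsI'-cut-new₂∈ S G H c₁ c₂ c₃ c₄ n+1∉S n+2∈S ⟩
  lhsI G H (cut S) + (+ 2 * + countC S c₁ c₂ c₃ c₄ - + 4)
    ≡⟨ cong₂ (λ L k → L + (+ 2 * k - + 4)) I-vanishes three ⟩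
  + 2  ∎
  where
  a : Fin 3 → Fin n
  a = a₁ ∷ a₂ ∷ a₃ ∷ []
  a-separated : ∀ i j → i ≢ j → ¬ SameComp H (a i) (a j)
  a-separated 0F 0F 0≢0 = contradiction refl 0≢0
  a-separated 1F 1F 1≢1 = contradiction refl 1≢1
  a-separated 2F 2F 2≢2 = contradiction refl 2≢2
  a-separated 0F 1F _   = a₁≁a₂
  a-separated 0F 2F _   = a₁≁a₃
  a-separated 1F 2F _   = a₂≁a₃
  a-separated 1F 0F _   = a₁≁a₂ ∘ Components.SameComp-sym H
  a-separated 2F 0F _   = a₁≁a₃ ∘ Components.SameComp-sym H
  a-separated 2F 1F _   = a₂≁a₃ ∘ Components.SameComp-sym H
  S≡anyF : ∀ u → S (old u) ≡ anyF (λ i → sameCompᵇ H (a i) u)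
  S≡anyF u =
    trans (S≡⋃ u) (cong (λ t → sameCompᵇ H a₁ u ∨ (sameCompᵇ H a₂ u ∨ t)) (sym (∨-identityʳ _)))
  a∈C : ∀ i → ∃[ k ] a i ≡ corner c₁ c₂ c₃ c₄ k
  a∈C 0F = inC→corner a₁∈C
  a∈C 1F = inC→corner a₂∈C
  a∈C 2F = inC→corner a₃∈C
  I-vanishes : lhsI G H (cut S) ≡ + 0
  I-vanishes = lhsI-union {G = G} {H = H} M CC a a-separated S S≡anyF n+1∉S
  three : + countC S c₁ c₂ c₃ c₄ ≡ + 3
  three = trans (countC-as-ΣZ S c₁ c₂ c₃ c₄)
                (union-count {G = G} {H = H} M CC a a-separated S S≡anyF
                             (corner c₁ c₂ c₃ c₄) (corners-separated {H = H} M CC C) a∈C)
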